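{- Let $G=(V,E)$ be a graph on $n$ vertices with a fixed perfect matching $\mathrm{OPT}$, and let $k\ge 1$ be an integer. Over all possible outputs of \textsc{Ranking} on $G$ (i.e., over all permutations of $V$), there are at most $\binom{n/2}{2k}\cdot 3^k$ distinct vertex sets that are $k$-wasteful independent sets.
   Context: The \textsc{Ranking} algorithm on $G$: given a permutation $\pi$ of $V$ (chosen uniformly at random), iterate over the vertices in the order of $\pi$, and when processing a still-unmatched vertex, match it to its first (in the order of $\pi$) currently unmatched neighbor, if any; the output is the resulting (maximal) matching $R$. An augmenting path for $R$ is a path whose edges alternate between edges of $\mathrm{OPT}$ and edges of $R$ and whose two endpoints are unmatched in $R$; a length-three augmenting path consists of an $\mathrm{OPT}$ edge, an $R$ edge, and an $\mathrm{OPT}$ edge. Given the output $R$, a set $I$ of $2k$ vertices is a $k$-wasteful independent set ($k$-WIS) if the vertices of $I$ are exactly the $2k$ endpoints of $k$ (vertex-disjoint) length-three augmenting paths in $R\oplus \mathrm{OPT}$. -}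

module Defs where

open import Data.Nat using (ℕ; _*_; _+_)
open import Data.Bool using (Bool; true; false; if_then_else_; _∧_)
open import Data.Maybe using (Maybe; just; nothing; is-nothing)
open import Data.Fin using (Fin; _≟_)
open import Data.Fin.Subset using (Subset; _∈_)
open import Data.Fin.Permutation using (Permutation′; _⟨$⟩ʳ_)
open import Data.List using (List; []; _∷_; map; foldl; allFin)
open import Data.Product using (Σ; ∃; _×_; _,_)
open import Data.Sum using (_⊎_)
open import Relation.Binary.PropositionalEquality using (_≡_)
open import Relation.Nullary using (¬_; yes; no)
open import Function.Definitions using (Injective)

record Graph (n : ℕ) : Set where
  field
    adj   : Fin n → Fin n → Bool
    sym   : ∀ u v → adj u v ≡ adj v u
    irrefl : ∀ v → adj v v ≡ false
open Graph public

record PerfectMatching {n : ℕ} (G : Graph n) : Set where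
  field
    partner   : Fin n → Fin n
    involutive : ∀ v → partner (partner v) ≡ v
    noFix     : ∀ v → ¬ (partner v ≡ v)
    isEdge    : ∀ v → adj G v (partner v) ≡ true
open PerfectMatching public

-- A (partial) matching state: each vertex's partner, if matched.
MatchState : ℕ → Set
MatchState n = Fin n → Maybe (Fin n)

order : ∀ {n} → Permutation′ n → List (Fin n)
order {n} π = map (π ⟨$⟩ʳ_) (allFin n)

firstFree : ∀ {n} → Graph n → MatchState n → Fin n → List (Fin n) → Maybe (Fin n)
firstFree G M v [] = nothing
firstFree G M v (u ∷ us) =
  if adj G v u ∧ is-nothing (M u) then just u else firstFree G M v us

matchPair : ∀ {n} → MatchState n → Fin n → Fin n → MatchState n
matchPair M v u w with w ≟ v
... | yes _ = just u
... | no _ with w ≟ u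
...   | yes _ = just v
...   | no _  = M w

rankStep : ∀ {n} → Graph n → List (Fin n) → MatchState n → Fin n → MatchState n
rankStep G ord M v with M v
... | just _  = M
... | nothing with firstFree G M v ord
...   | nothing = M
...   | just u  = matchPair M v u

ranking : ∀ {n} → Graph n → Permutation′ n → MatchState n
ranking G π = foldl (rankStep G (order π)) (λ _ → nothing) (order π)

record AugPath3 {n : ℕ} {G : Graph n} (OPT : PerfectMatching G) (R : MatchState n) : Set where
  field
    a b c d : Fin n
    ab-opt  : partner OPT a ≡ b
    bc-R    : R b ≡ just c
    cd-opt  : partner OPT c ≡ d
    a-free  : R a ≡ nothing
    d-free  : R d ≡ nothing
open AugPath3 public

pathVertex : ∀ {n} {G : Graph n} {OPT : PerfectMatching G} {R : MatchState n} →
             AugPath3 OPT R → Fin 4 → Fin n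
pathVertex P Fin.zero = a P
pathVertex P (Fin.suc Fin.zero) = b P
pathVertex P (Fin.suc (Fin.suc Fin.zero)) = c P
pathVertex P (Fin.suc (Fin.suc (Fin.suc Fin.zero))) = d P

-- I is a k-wasteful independent set for R: I has 2k vertices and is exactly
-- the set of the 2k endpoints of k vertex-disjoint length-three augmenting paths.
-- (Vertex-disjointness, together with distinctness of the 4 vertices of each
-- path, is expressed by injectivity of (path index, position) ↦ vertex.)
IsWIS : ∀ {n} {G : Graph n} → PerfectMatching G → MatchState n → ℕ → Subset n → Set
IsWIS {n} OPT R k I =
  Data.Fin.Subset.∣ I ∣ ≡ 2 * k ×
  Σ (Fin k → AugPath3 OPT R) λ P →
    Injective _≡_ _≡_ (λ (ij : Fin k × Fin 4) → pathVertex (P (Data.Product.proj₁ ij)) (Data.Product.proj₂ ij)) ×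
    (∀ v → (v ∈ I → ∃ λ i → v ≡ a (P i) ⊎ v ≡ d (P i)) ×
           ((∃ λ i → v ≡ a (P i) ⊎ v ≡ d (P i)) → v ∈ I))

IsRankingWIS : ∀ {n} (G : Graph n) → PerfectMatching G → ℕ → Subset n → Set
IsRankingWIS {n} G OPT k I = ∃ λ (π : Permutation′ n) → IsWIS OPT (ranking G π) k I

module Submission where

-- A k-WIS I is transversal to OPT (it contains at most one end of every OPT
-- edge), and it is independent in G, since its vertices are free in the maximal
-- matching produced by Ranking.  Naming every OPT edge by its end of smaller
-- index, the 2k OPT edges met by I form a 2k-subset of a fixed set of n/2
-- vertices: at most C(n/2, 2k) possibilities.  Among the k-WISs meeting the same
-- OPT edges, fix one together with its augmenting paths a – b – c – d.  Any
-- other such J contains exactly one end of each OPT edge {a, b}, {c, d}, so it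
-- is determined by which of a, d it contains on every path; it cannot omit both,
-- for then it would contain the two ends of the Ranking edge {b, c}.  That
-- leaves 3 choices per path, i.e. at most 3^k sets per choice of OPT edges.

open import Defs hiding (sym)
open import Level using (0ℓ)
open import Data.Nat using (ℕ; zero; suc; _+_; _*_; _^_; _/_; _≤_; _<ᵇ_; z≤n; s≤s; s≤s⁻¹)
open import Data.Nat.Properties
  using (≤-trans; ≤-reflexive; +-mono-≤; +-suc; +-identityʳ; *-comm; suc-injective;
         +-0-commutativeMonoid)
open import Data.Nat.DivMod using (m*n/n≡m)
open import Data.Nat.Combinatorics using (_C_; nCk+nC[k+1]≡[n+1]C[k+1])
open import Data.Bool using (Bool; true; false; _∧_; _∨_; not)
import Data.Bool.Properties as Bool
open import Data.Maybe using (just; nothing)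
open import Data.Fin using (Fin; zero; suc; toℕ; _≟_)
open import Data.Fin.Properties using (toℕ-injective)
open import Data.Fin.Patterns using (0F; 1F; 2F; 3F)
open import Data.Fin.Permutation using (Permutation′; _⟨$⟩ʳ_; _⟨$⟩ˡ_; inverseʳ; permutation)
open import Data.Fin.Subset using (Subset; _∈_; _⊆_; ∣_∣; inside; outside)
open import Data.Fin.Subset.Properties using (drop-∷-⊆)
open import Data.Vec using (Vec; []; _∷_; head; tail; here; lookup; tabulate)
open import Data.Vec.Properties
  using (lookup∘tabulate; tabulate∘lookup; tabulate-cong; []=⇒lookup; lookup⇒[]=; ≡-dec)
open import Data.Vec.Relation.Unary.All using ([]; _∷_) renaming (All to AllV)
open import Data.Vec.Relation.Unary.All.Properties using (tabulate⁺)
open import Data.List using (List; []; _∷_; length; map; filter; foldl)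
open import Data.List.Properties using (length-map)
open import Data.List.Relation.Unary.All as All using (All; []; _∷_)
import Data.List.Relation.Unary.All.Properties as All
open import Data.List.Relation.Unary.AllPairs using ([]; _∷_)
open import Data.List.Relation.Unary.Any using (here; there)
open import Data.List.Relation.Unary.Unique.Propositional using (Unique)
import Data.List.Relation.Unary.Unique.Propositional.Properties as Unique
open import Data.List.Membership.Propositional using () renaming (_∈_ to _∈ˡ_)
open import Data.List.Membership.Propositional.Properties using (∈-map⁺; ∈-allFin)
open import Data.Product using (∃; _×_; _,_; proj₁; proj₂)
import Data.Product.Properties as Product
open import Data.Sum using (_⊎_; inj₁; inj₂)
open import Data.Empty using (⊥; ⊥-elim)
open import Function using (_∘_; case_of_)
open import Relation.Nullary using (¬_; yes; no)
open import Relation.Unary using (Pred; Decidable; _∩_; ∁)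
open import Relation.Unary.Properties using (∁?)
open import Relation.Binary.Definitions using (DecidableEquality)
open import Relation.Binary.PropositionalEquality
  using (_≡_; _≢_; _≗_; refl; sym; trans; cong; cong₂; subst; subst₂; module ≡-Reasoning)
open import Algebra.Properties.CommutativeMonoid.Sum +-0-commutativeMonoid
  using (sum; sum-cong-≗; sum-permute; ∑-distrib-+)

-- Counting distinct elements

AtMost : {A : Set} → ℕ → Pred A 0ℓ → Set
AtMost {A} N P = (xs : List A) → Unique xs → All P xs → length xs ≤ N

atMost-weaken : {A : Set} {P Q : Pred A 0ℓ} {N : ℕ} → (∀ {x} → P x → Q x) → AtMost N Q → AtMost N P
atMost-weaken P⇒Q ∣Q∣≤N xs u ps = ∣Q∣≤N xs u (All.map P⇒Q ps)

module _ {A : Set} {P : Pred A 0ℓ} where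

  atMost-mono : {M N : ℕ} → M ≤ N → AtMost M P → AtMost N P
  atMost-mono M≤N ∣P∣≤M xs u ps = ≤-trans (∣P∣≤M xs u ps) M≤N

  atMost-inhabited : {N : ℕ} → (∀ {x} → P x → AtMost N P) → AtMost N P
  atMost-inhabited bound []       _ _          = z≤n
  atMost-inhabited bound (x ∷ xs) u ps@(px ∷ _) = bound px (x ∷ xs) u ps

  atMost-empty : (∀ {x} → ¬ P x) → AtMost 0 P
  atMost-empty ¬P []      _ _        = z≤n
  atMost-empty ¬P (_ ∷ _) _ (px ∷ _) = ⊥-elim (¬P px)

  atMost-subsingleton : (∀ {x y} → P x → P y → x ≡ y) → AtMost 1 P
  atMost-subsingleton same []          _                _              = z≤n
  atMost-subsingleton same (_ ∷ [])    _                _              = s≤s z≤n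
  atMost-subsingleton same (_ ∷ _ ∷ _) ((x≢y ∷ _) ∷ _) (px ∷ py ∷ _) = ⊥-elim (x≢y (same px py))

  length-filter-∁ : {D : Pred A 0ℓ} (D? : Decidable D) (xs : List A) →
                    length (filter D? xs) + length (filter (∁? D?) xs) ≡ length xs
  length-filter-∁ D? []       = refl
  length-filter-∁ D? (x ∷ xs) with D? x
  ... | yes _ = cong suc (length-filter-∁ D? xs)
  ... | no  _ = trans (+-suc _ _) (cong suc (length-filter-∁ D? xs))

  atMost-split : {D : Pred A 0ℓ} {M N : ℕ} → Decidable D →
                 AtMost M (P ∩ D) → AtMost N (P ∩ ∁ D) → AtMost (M + N) P
  atMost-split D? ∣P∩D∣≤M ∣P∖D∣≤N xs u ps
    rewrite sym (length-filter-∁ D? xs) =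
    +-mono-≤ (∣P∩D∣≤M _ (Unique.filter⁺ D? u) (restrict D?))
             (∣P∖D∣≤N _ (Unique.filter⁺ (∁? D?) u) (restrict (∁? D?)))
    where
    restrict : {E : Pred A 0ℓ} (E? : Decidable E) → All (P ∩ E) (filter E? xs)
    restrict E? = All.zipWith (λ x → x) (All.filter⁺ E? ps , All.all-filter E? xs)

  atMost-remove : {N : ℕ} {y : A} → P y → AtMost (suc N) P → AtMost N (λ x → P x × x ≢ y)
  atMost-remove py ∣P∣≤1+N xs u ps = s≤s⁻¹ (∣P∣≤1+N (_ ∷ xs) (y∉xs ∷ u) (py ∷ All.map proj₁ ps))
    where y∉xs = All.map (λ (_ , x≢y) y≡x → x≢y (sym y≡x)) ps

atMost-∈ : {A : Set} → DecidableEquality A → (L : List A) → AtMost (length L) (_∈ˡ L)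
atMost-∈ _≟_ []      = atMost-empty (λ ())
atMost-∈ _≟_ (y ∷ L) = atMost-split {D = _≡ y} (_≟ y)
  (atMost-subsingleton (λ (_ , x≡y) (_ , x′≡y) → trans x≡y (sym x′≡y)))
  (atMost-weaken (λ { (here x≡y , x≢y) → ⊥-elim (x≢y x≡y) ; (there x∈L , _) → x∈L })
                 (atMost-∈ _≟_ L))

module _ {A B : Set} {P : Pred A 0ℓ} {Q : Pred B 0ℓ} where

  unique-map : (f : A → B) → (∀ {x y} → P x → P y → f x ≡ f y → x ≡ y) →
               ∀ {xs} → Unique xs → All P xs → Unique (map f xs)
  unique-map f inj []            []         = []
  unique-map f inj (x∉xs ∷ u)    (px ∷ ps)  =
    All.map⁺ (All.zipWith (λ (x≢y , py) fx≡fy → x≢y (inj px py fx≡fy)) (x∉xs , ps))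
    ∷ unique-map f inj u ps

  atMost-injection : {N : ℕ} (f : A → B) → (∀ {x} → P x → Q (f x)) →
                     (∀ {x y} → P x → P y → f x ≡ f y → x ≡ y) →
                     AtMost N Q → AtMost N P
  atMost-injection f P⇒Q inj ∣Q∣≤N xs u ps =
    ≤-trans (≤-reflexive (sym (length-map f xs)))
            (∣Q∣≤N (map f xs) (unique-map f inj u ps) (All.map⁺ (All.map P⇒Q ps)))

atMost-zero : {A : Set} {P : Pred A 0ℓ} {x : A} → AtMost 0 P → ¬ P x
atMost-zero ∣P∣≤0 px = case ∣P∣≤0 (_ ∷ []) ([] ∷ []) (px ∷ []) of λ ()

atMost-fibres : {A B : Set} {P : Pred A 0ℓ} {Q : Pred B 0ℓ} {N : ℕ} →
                DecidableEquality B → (f : A → B) → (∀ {x} → P x → Q (f x)) →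
                (∀ y → AtMost N (λ x → P x × f x ≡ y)) →
                ∀ M → AtMost M Q → AtMost (M * N) P
atMost-fibres _≟_ f P⇒Q fibre zero    ∣Q∣≤0 =
  atMost-empty (λ px → atMost-zero ∣Q∣≤0 (P⇒Q px))
atMost-fibres {Q = Q} _≟_ f P⇒Q fibre (suc M) ∣Q∣≤1+M = atMost-inhabited λ {x} px →
  atMost-split {D = λ z → f z ≡ f x} (λ z → f z ≟ f x) (fibre (f x))
    (atMost-fibres {Q = λ y → Q y × y ≢ f x} _≟_ f (λ (pz , fz≢fx) → P⇒Q pz , fz≢fx)
                   (λ y → atMost-weaken (λ ((pz , _) , fz≡y) → pz , fz≡y) (fibre y))
                   M (atMost-remove (P⇒Q px) ∣Q∣≤1+M))

atMost-∷ : ∀ {A : Set} {n N} (x : A) {V : Pred (Vec A (suc n)) 0ℓ} → AtMost N (λ xs → V (x ∷ xs)) →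
           AtMost N (λ xs → V xs × head xs ≡ x)
atMost-∷ x = atMost-injection tail (λ { {_ ∷ _} (v , refl) → v })
               (λ { {_ ∷ _} {_ ∷ _} (_ , refl) (_ , refl) refl → refl })

atMost-All : ∀ {A : Set} {P : Pred A 0ℓ} {m} → DecidableEquality A → AtMost m P →
             ∀ k → AtMost (m ^ k) (AllV P {k})
atMost-All _≟_ ∣P∣≤m zero    = atMost-subsingleton (λ { {[]} {[]} _ _ → refl })
atMost-All {m = m} _≟_ ∣P∣≤m (suc k) =
  atMost-fibres _≟_ head (λ { (px ∷ _) → px })
    (λ x → atMost-∷ x (atMost-weaken (λ { (_ ∷ pxs) → pxs }) (atMost-All _≟_ ∣P∣≤m k)))
    m ∣P∣≤m

atMost-Bool-∷ : ∀ {n M N} {V : Pred (Subset (suc n)) 0ℓ} →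
                AtMost M (λ X → V (inside ∷ X)) → AtMost N (λ X → V (outside ∷ X)) → AtMost (M + N) V
atMost-Bool-∷ ∣V₁∣≤M ∣V₀∣≤N = atMost-split (λ xs → head xs Bool.≟ inside)
  (atMost-∷ inside ∣V₁∣≤M)
  (atMost-weaken (λ (v , x≢inside) → v , Bool.¬-not x≢inside) (atMost-∷ outside ∣V₀∣≤N))

atMost-subsets : ∀ {n} (Q : Subset n) r → AtMost (∣ Q ∣ C r) (λ X → X ⊆ Q × ∣ X ∣ ≡ r)
atMost-subsets []            zero    = atMost-subsingleton (λ { {[]} {[]} _ _ → refl })
atMost-subsets []            (suc r) = atMost-empty (λ { {[]} (_ , ()) })
atMost-subsets (outside ∷ Q) r       = atMost-Bool-∷ {M = 0}
  (atMost-empty (λ (X⊆Q , _) → case X⊆Q here of λ ()))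
  (atMost-weaken (λ (X⊆Q , ∣X∣≡r) → drop-∷-⊆ X⊆Q , ∣X∣≡r) (atMost-subsets Q r))
atMost-subsets (inside ∷ Q)  zero    = atMost-Bool-∷ {M = 0}
  (atMost-empty (λ { (_ , ()) }))
  (atMost-weaken (λ (X⊆Q , ∣X∣≡0) → drop-∷-⊆ X⊆Q , ∣X∣≡0) (atMost-subsets Q 0))
atMost-subsets (inside ∷ Q)  (suc r) = atMost-mono
  (≤-reflexive (nCk+nC[k+1]≡[n+1]C[k+1] ∣ Q ∣ r))
  (atMost-Bool-∷
    (atMost-weaken (λ (X⊆Q , ∣X∣≡1+r) → drop-∷-⊆ X⊆Q , suc-injective ∣X∣≡1+r) (atMost-subsets Q r))
    (atMost-weaken (λ (X⊆Q , ∣X∣≡1+r) → drop-∷-⊆ X⊆Q , ∣X∣≡1+r) (atMost-subsets Q (suc r))))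

SomeTrue : Bool × Bool → Set
SomeTrue (x , y) = x ∨ y ≡ true

atMost-someTrue : AtMost 3 SomeTrue
atMost-someTrue = atMost-weaken
  (λ { {true , true} _ → here refl ; {true , false} _ → there (here refl)
     ; {false , true} _ → there (there (here refl)) ; {false , false} () })
  (atMost-∈ (Product.≡-dec Bool._≟_ Bool._≟_) ((true , true) ∷ (true , false) ∷ (false , true) ∷ []))

-- Ranking outputs a maximal matching of G

Free : ∀ {n} → MatchState n → Fin n → Set
Free M v = M v ≡ nothing

_⊑_ : ∀ {n} → MatchState n → MatchState n → Set
M ⊑ M′ = ∀ {v} → Free M′ v → Free M v

module _ {n : ℕ} (G : Graph n) where

  EdgesIn : MatchState n → Set
  EdgesIn M = ∀ {u v} → M u ≡ just v → adj G u v ≡ true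

  Maximal : MatchState n → Set
  Maximal M = ∀ {u v} → Free M u → Free M v → adj G u v ≡ true → ⊥

  Saturated : List (Fin n) → MatchState n → Fin n → Set
  Saturated ord M v = Free M v → ∀ {u} → u ∈ˡ ord → adj G v u ≡ true → ¬ Free M u

  saturated-⊑ : ∀ {ord M M′ v} → M ⊑ M′ → Saturated ord M v → Saturated ord M′ v
  saturated-⊑ M⊑M′ sat v-free u∈ord vu u-free = sat (M⊑M′ v-free) u∈ord vu (M⊑M′ u-free)

  firstFree-adj : ∀ M v us {u} → firstFree G M v us ≡ just u → adj G v u ≡ true
  firstFree-adj M v (w ∷ us) found with adj G v w in vw | M w
  ... | true  | nothing = case found of λ { refl → vw }
  ... | true  | just _  = firstFree-adj M v us found
  ... | false | _       = firstFree-adj M v us found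

  firstFree-nothing : ∀ M v us → firstFree G M v us ≡ nothing →
                      All (λ u → adj G v u ≡ true → ¬ Free M u) us
  firstFree-nothing M v []       _ = []
  firstFree-nothing M v (w ∷ us) none with adj G v w in vw | M w in Mw
  ... | true  | nothing = case none of λ ()
  ... | true  | just _  = (λ _ w-free → case trans (sym Mw) w-free of λ ())
                          ∷ firstFree-nothing M v us none
  ... | false | _       = (λ vw′ → case trans (sym vw) vw′ of λ ())
                          ∷ firstFree-nothing M v us none

  matchPair-⊑ : ∀ (M : MatchState n) v u → M ⊑ matchPair M v u
  matchPair-⊑ M v u {w} free with w ≟ v
  ... | yes _ = case free of λ ()
  ... | no  _ with w ≟ u
  ...   | yes _ = case free of λ ()
  ...   | no  _ = free

  matchPair-edges : ∀ M v u → EdgesIn M → adj G v u ≡ true → EdgesIn (matchPair M v u)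
  matchPair-edges M v u edges vu {w} matched with w ≟ v
  ... | yes refl = case matched of λ { refl → vu }
  ... | no  _ with w ≟ u
  ...   | yes refl = case matched of λ { refl → trans (Graph.sym G u v) vu }
  ...   | no  _    = edges matched

  matchPair-matches : ∀ (M : MatchState n) v u → ¬ Free (matchPair M v u) v
  matchPair-matches M v u with v ≟ v
  ... | yes _  = λ ()
  ... | no v≢v = case v≢v refl of λ ()

  module _ (ord : List (Fin n)) where

    rankStep-⊑ : ∀ M v → M ⊑ rankStep G ord M v
    rankStep-⊑ M v with M v
    ... | just _  = λ free → free
    ... | nothing with firstFree G M v ord
    ...   | nothing = λ free → free
    ...   | just u  = matchPair-⊑ M v u

    rankStep-edges : ∀ M v → EdgesIn M → EdgesIn (rankStep G ord M v)
    rankStep-edges M v edges with M v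
    ... | just _  = edges
    ... | nothing with firstFree G M v ord in found
    ...   | nothing = edges
    ...   | just u  = matchPair-edges M v u edges (firstFree-adj M v ord found)

    rankStep-saturates : ∀ M v → Saturated ord (rankStep G ord M v) v
    rankStep-saturates M v with M v in Mv
    ... | just _  = λ v-free → case trans (sym Mv) v-free of λ ()
    ... | nothing with firstFree G M v ord in found
    ...   | nothing = λ _ u∈ord → All.lookup (firstFree-nothing M v ord found) u∈ord
    ...   | just u  = λ v-free → case matchPair-matches M v u v-free of λ ()

    greedy-⊑ : ∀ vs M → M ⊑ foldl (rankStep G ord) M vs
    greedy-⊑ []       M free = free
    greedy-⊑ (v ∷ vs) M free = rankStep-⊑ M v (greedy-⊑ vs _ free)

    greedy-edges : ∀ vs M → EdgesIn M → EdgesIn (foldl (rankStep G ord) M vs)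
    greedy-edges []       M edges = edges
    greedy-edges (v ∷ vs) M edges = greedy-edges vs _ (rankStep-edges M v edges)

    greedy-saturates : ∀ vs M {v} → v ∈ˡ vs → Saturated ord (foldl (rankStep G ord) M vs) v
    greedy-saturates (v ∷ vs) M (here refl) = saturated-⊑ (greedy-⊑ vs _) (rankStep-saturates M v)
    greedy-saturates (_ ∷ vs) M (there v∈vs) = greedy-saturates vs _ v∈vs

  ∈-order : (π : Permutation′ n) (v : Fin n) → v ∈ˡ order π
  ∈-order π v = subst (_∈ˡ order π) (inverseʳ π) (∈-map⁺ (π ⟨$⟩ʳ_) (∈-allFin (π ⟨$⟩ˡ v)))

  ranking-edges : (π : Permutation′ n) → EdgesIn (ranking G π)
  ranking-edges π = greedy-edges (order π) (order π) (λ _ → nothing) (λ ())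

  ranking-maximal : (π : Permutation′ n) → Maximal (ranking G π)
  ranking-maximal π {u} {v} u-free v-free uv =
    greedy-saturates (order π) (order π) (λ _ → nothing) (∈-order π u) u-free (∈-order π v) uv v-free

𝟙 : Bool → ℕ
𝟙 true  = 1
𝟙 false = 0

𝟙-split : ∀ l b → 𝟙 b ≡ 𝟙 (l ∧ b) + 𝟙 (not l ∧ b)
𝟙-split true  b = sym (+-identityʳ (𝟙 b))
𝟙-split false b = refl

𝟙-∨-disjoint : ∀ l a b → (a ≡ true → b ≡ true → ⊥) → 𝟙 (l ∧ (a ∨ b)) ≡ 𝟙 (l ∧ a) + 𝟙 (l ∧ b)
𝟙-∨-disjoint false _     _     _  = refl
𝟙-∨-disjoint true  true  true  ab = ⊥-elim (ab refl refl)
𝟙-∨-disjoint true  true  false _  = refl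
𝟙-∨-disjoint true  false _     _  = refl

∨-bridge : ∀ {a b c d} → a ∨ b ≡ true → d ∨ c ≡ true → (b ≡ true → c ≡ true → ⊥) → a ∨ d ≡ true
∨-bridge {true}                _ _ _  = refl
∨-bridge {false} {d = true}    _ _ _  = refl
∨-bridge {false} {d = false} b c bc = ⊥-elim (bc b c)

<ᵇ-flip : ∀ {m n} → m ≢ n → (m <ᵇ n) ≡ not (n <ᵇ m)
<ᵇ-flip {zero}  {zero}  m≢n = ⊥-elim (m≢n refl)
<ᵇ-flip {zero}  {suc n} _   = refl
<ᵇ-flip {suc m} {zero}  _   = refl
<ᵇ-flip {suc m} {suc n} m≢n = <ᵇ-flip (m≢n ∘ cong suc)

sum-ones : ∀ n → sum {n} (λ _ → 1) ≡ n
sum-ones zero    = refl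
sum-ones (suc n) = cong suc (sum-ones n)

∣tabulate∣ : ∀ {n} (f : Fin n → Bool) → ∣ tabulate f ∣ ≡ sum (𝟙 ∘ f)
∣tabulate∣ {zero}  f = refl
∣tabulate∣ {suc n} f with f zero
... | true  = cong suc (∣tabulate∣ (f ∘ suc))
... | false = ∣tabulate∣ (f ∘ suc)

∈-tabulate⁻ : ∀ {n} {f : Fin n → Bool} {v} → v ∈ tabulate f → f v ≡ true
∈-tabulate⁻ {f = f} {v} v∈ = trans (sym (lookup∘tabulate f v)) ([]=⇒lookup v∈)

lookup-extensionality : ∀ {A : Set} {n} {xs ys : Vec A n} →
                        (∀ i → lookup xs i ≡ lookup ys i) → xs ≡ ys
lookup-extensionality {xs = xs} {ys} eq =
  trans (sym (tabulate∘lookup xs)) (trans (tabulate-cong eq) (tabulate∘lookup ys))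

module _ {n : ℕ} (σ : Permutation′ n) (low : Fin n → Bool)
         (low-flip : ∀ v → low (σ ⟨$⟩ʳ v) ≡ not (low v)) where

  sum-halves : ∀ (g : Fin n → Bool) →
               sum (𝟙 ∘ g) ≡ sum (λ v → 𝟙 (low v ∧ g v)) + sum (λ v → 𝟙 (low v ∧ g (σ ⟨$⟩ʳ v)))
  sum-halves g = begin
    sum (𝟙 ∘ g)
      ≡⟨ sum-cong-≗ (λ v → 𝟙-split (low v) (g v)) ⟩
    sum (λ v → 𝟙 (low v ∧ g v) + 𝟙 (not (low v) ∧ g v))
      ≡⟨ ∑-distrib-+ (λ v → 𝟙 (low v ∧ g v)) (λ v → 𝟙 (not (low v) ∧ g v)) ⟩
    sum (λ v → 𝟙 (low v ∧ g v)) + sum (λ v → 𝟙 (not (low v) ∧ g v))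
      ≡⟨ cong (sum (λ v → 𝟙 (low v ∧ g v)) +_) (sum-permute (λ v → 𝟙 (not (low v) ∧ g v)) σ) ⟩
    sum (λ v → 𝟙 (low v ∧ g v)) + sum (λ v → 𝟙 (not (low (σ ⟨$⟩ʳ v)) ∧ g (σ ⟨$⟩ʳ v)))
      ≡⟨ cong (sum (λ v → 𝟙 (low v ∧ g v)) +_) (sum-cong-≗ λ v →
           cong (λ l → 𝟙 (l ∧ g (σ ⟨$⟩ʳ v)))
                (trans (cong not (low-flip v)) (Bool.not-involutive (low v)))) ⟩
    sum (λ v → 𝟙 (low v ∧ g v)) + sum (λ v → 𝟙 (low v ∧ g (σ ⟨$⟩ʳ v))) ∎
    where open ≡-Reasoning

-- The OPT edges met by a vertex set

module _ {n : ℕ} {G : Graph n} (OPT : PerfectMatching G) where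

  private
    p : Fin n → Fin n
    p = partner OPT

  lowerEnd : Fin n → Bool
  lowerEnd v = toℕ v <ᵇ toℕ (p v)

  lowerEnds : Subset n
  lowerEnds = tabulate lowerEnd

  covered : Subset n → Fin n → Bool
  covered J v = lookup J v ∨ lookup J (p v)

  coveredEdges : Subset n → Subset n
  coveredEdges J = tabulate (λ v → lowerEnd v ∧ covered J v)

  Transversal : Subset n → Set
  Transversal J = ∀ {v} → v ∈ J → p v ∈ J → ⊥

  lowerEnd-partner : ∀ v → lowerEnd (p v) ≡ not (lowerEnd v)
  lowerEnd-partner v rewrite involutive OPT v =
    <ᵇ-flip (λ pv≡v → noFix OPT v (toℕ-injective pv≡v))

  covered-partner : ∀ J v → covered J (p v) ≡ covered J v
  covered-partner J v rewrite involutive OPT v = Bool.∨-comm (lookup J (p v)) (lookup J v)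

  covered-∈ : ∀ {J v} → v ∈ J → covered J v ≡ true
  covered-∈ {J} {v} v∈J = cong (_∨ lookup J (p v)) ([]=⇒lookup v∈J)

  private
    σ : Permutation′ n
    σ = permutation p p (involutive OPT) (involutive OPT)

  ∣lowerEnds∣≡n/2 : ∣ lowerEnds ∣ ≡ n / 2
  ∣lowerEnds∣≡n/2 = begin
    L                 ≡⟨ m*n/n≡m L 2 ⟨
    L * 2 / 2         ≡⟨ cong (_/ 2) (trans (*-comm L 2) (cong (L +_) (+-identityʳ L))) ⟩
    (L + L) / 2       ≡⟨ cong (_/ 2) L+L≡n ⟩
    n / 2             ∎
    where
    open ≡-Reasoning
    L = ∣ lowerEnds ∣
    ∣lowerEnds∣≡sum : L ≡ sum (λ v → 𝟙 (lowerEnd v ∧ true))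
    ∣lowerEnds∣≡sum = trans (∣tabulate∣ lowerEnd)
                            (sum-cong-≗ (λ v → cong 𝟙 (sym (Bool.∧-identityʳ (lowerEnd v)))))
    L+L≡n : L + L ≡ n
    L+L≡n = begin
      L + L
        ≡⟨ cong₂ _+_ ∣lowerEnds∣≡sum ∣lowerEnds∣≡sum ⟩
      sum (λ v → 𝟙 (lowerEnd v ∧ true)) + sum (λ v → 𝟙 (lowerEnd v ∧ true))
        ≡⟨ sum-halves σ lowerEnd lowerEnd-partner (λ _ → true) ⟨
      sum {n} (λ _ → 1)
        ≡⟨ sum-ones n ⟩
      n ∎

  ∣coveredEdges∣ : ∀ {J} → Transversal J → ∣ coveredEdges J ∣ ≡ ∣ J ∣
  ∣coveredEdges∣ {J} transversal = begin
    ∣ coveredEdges J ∣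
      ≡⟨ ∣tabulate∣ (λ v → lowerEnd v ∧ covered J v) ⟩
    sum (λ v → 𝟙 (lowerEnd v ∧ covered J v))
      ≡⟨ sum-cong-≗ (λ v → 𝟙-∨-disjoint (lowerEnd v) (lookup J v) (lookup J (p v))
                             (λ Jv Jpv → transversal (lookup⇒[]= v J Jv) (lookup⇒[]= (p v) J Jpv))) ⟩
    sum (λ v → 𝟙 (lowerEnd v ∧ lookup J v) + 𝟙 (lowerEnd v ∧ lookup J (p v)))
      ≡⟨ ∑-distrib-+ (λ v → 𝟙 (lowerEnd v ∧ lookup J v)) (λ v → 𝟙 (lowerEnd v ∧ lookup J (p v))) ⟩
    sum (λ v → 𝟙 (lowerEnd v ∧ lookup J v)) + sum (λ v → 𝟙 (lowerEnd v ∧ lookup J (p v)))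
      ≡⟨ sum-halves σ lowerEnd lowerEnd-partner (lookup J) ⟨
    sum (𝟙 ∘ lookup J)
      ≡⟨ ∣tabulate∣ (lookup J) ⟨
    ∣ tabulate (lookup J) ∣
      ≡⟨ cong ∣_∣ (tabulate∘lookup J) ⟩
    ∣ J ∣ ∎
    where open ≡-Reasoning

  coveredEdges⊆lowerEnds : ∀ {J} → coveredEdges J ⊆ lowerEnds
  coveredEdges⊆lowerEnds {J} {v} v∈ =
    lookup⇒[]= v lowerEnds (trans (lookup∘tabulate lowerEnd v) (∧-true (∈-tabulate⁻ v∈)))
    where
    ∧-true : ∀ {x y} → x ∧ y ≡ true → x ≡ true
    ∧-true {true} _ = refl

  coveredEdges-agree : ∀ {J J′ u} → coveredEdges J ≡ coveredEdges J′ → lowerEnd u ≡ true →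
                       covered J u ≡ covered J′ u
  coveredEdges-agree {J} {J′} {u} eq low = subst (λ l → l ∧ covered J u ≡ l ∧ covered J′ u) low
    (trans (sym (lookup∘tabulate _ u)) (trans (cong (λ X → lookup X u) eq) (lookup∘tabulate _ u)))

  coveredEdges-injective : ∀ {J J′} → coveredEdges J ≡ coveredEdges J′ → covered J ≗ covered J′
  coveredEdges-injective {J} {J′} eq v with lowerEnd v in low
  ... | true  = coveredEdges-agree {J} {J′} eq low
  ... | false = begin
    covered J v        ≡⟨ covered-partner J v ⟨
    covered J (p v)    ≡⟨ coveredEdges-agree {J} {J′} eq (trans (lowerEnd-partner v) (cong not low)) ⟩
    covered J′ (p v)   ≡⟨ covered-partner J′ v ⟩
    covered J′ v       ∎
    where open ≡-Reasoning

  transversal-lookup : ∀ {J} → Transversal J → ∀ v → lookup J v ≡ covered J v ∧ not (lookup J (p v))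
  transversal-lookup {J} transversal v with lookup J v in Jv | lookup J (p v) in Jpv
  ... | true  | true  = ⊥-elim (transversal (lookup⇒[]= v J Jv) (lookup⇒[]= (p v) J Jpv))
  ... | true  | false = refl
  ... | false | true  = refl
  ... | false | false = refl

  transversal-unique : ∀ {S J J′} → Transversal J → Transversal J′ →
                       covered J ≗ covered S → covered J′ ≗ covered S →
                       (∀ {v} → v ∈ S → lookup J v ≡ lookup J′ v) → J ≡ J′
  transversal-unique {S} {J} {J′} tJ tJ′ cJ cJ′ agree = lookup-extensionality J≗J′
    where
    via-S : ∀ {K} → Transversal K → covered K ≗ covered S → ∀ v →
            lookup K v ≡ covered S v ∧ not (lookup K (p v))
    via-S {K} tK cK v = trans (transversal-lookup tK v) (cong (_∧ not (lookup K (p v))) (cK v))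
    J≗J′ : ∀ v → lookup J v ≡ lookup J′ v
    J≗J′ v with lookup S v in Sv | lookup S (p v) in Spv
    ... | true  | _     = agree (lookup⇒[]= v S Sv)
    ... | false | true  = begin
      lookup J v                            ≡⟨ via-S tJ cJ v ⟩
      covered S v ∧ not (lookup J (p v))
        ≡⟨ cong (λ x → covered S v ∧ not x) (agree (lookup⇒[]= (p v) S Spv)) ⟩
      covered S v ∧ not (lookup J′ (p v))   ≡⟨ via-S tJ′ cJ′ v ⟨
      lookup J′ v                           ∎
      where open ≡-Reasoning
    ... | false | false = trans (uncovered tJ cJ) (sym (uncovered tJ′ cJ′))
      where
      uncovered : ∀ {K} → Transversal K → covered K ≗ covered S → lookup K v ≡ false
      uncovered tK cK = trans (via-S tK cK v) (cong (_∧ _) (cong₂ _∨_ Sv Spv))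

Independent : ∀ {n} → Graph n → Subset n → Set
Independent G J = ∀ {u v} → u ∈ J → v ∈ J → adj G u v ≡ true → ⊥

module _ {n : ℕ} {G : Graph n} {OPT : PerfectMatching G} {R : MatchState n} where

  partner-d : (P : AugPath3 OPT R) → partner OPT (d P) ≡ c P
  partner-d P = trans (cong (partner OPT) (sym (cd-opt P))) (involutive OPT (c P))

  wis-transversal : ∀ {k I} → IsWIS OPT R k I → Transversal OPT I
  wis-transversal (_ , P , inj , covers) v∈I pv∈I
    with proj₁ (covers _) v∈I | proj₁ (covers _) pv∈I
  ... | i , inj₁ refl | j , inj₁ e = case inj {i , 1F} {j , 0F} (trans (sym (ab-opt (P i))) e) of λ ()
  ... | i , inj₁ refl | j , inj₂ e = case inj {i , 1F} {j , 3F} (trans (sym (ab-opt (P i))) e) of λ ()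
  ... | i , inj₂ refl | j , inj₁ e = case inj {i , 2F} {j , 0F} (trans (sym (partner-d (P i))) e) of λ ()
  ... | i , inj₂ refl | j , inj₂ e = case inj {i , 2F} {j , 3F} (trans (sym (partner-d (P i))) e) of λ ()

  wis-independent : ∀ {k I} → Maximal G R → IsWIS OPT R k I → Independent G I
  wis-independent {I = I} maximal (_ , P , _ , covers) u∈I v∈I = maximal (free u∈I) (free v∈I)
    where
    free : ∀ {v} → v ∈ I → Free R v
    free v∈I with proj₁ (covers _) v∈I
    ... | i , inj₁ refl = a-free (P i)
    ... | i , inj₂ refl = d-free (P i)

module _ {n : ℕ} {G : Graph n} (OPT : PerfectMatching G) {R₀ : MatchState n} {k : ℕ} {I₀ : Subset n}
         (R₀-edges : EdgesIn G R₀) (wis₀ : IsWIS OPT R₀ k I₀) where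

  private
    p : Fin n → Fin n
    p = partner OPT
    path : Fin k → AugPath3 OPT R₀
    path = proj₁ (proj₂ wis₀)
    ∈I₀⇒end : ∀ {v} → v ∈ I₀ → ∃ λ i → v ≡ a (path i) ⊎ v ≡ d (path i)
    ∈I₀⇒end = proj₁ (proj₂ (proj₂ (proj₂ wis₀)) _)
    end⇒∈I₀ : ∀ {v i} → v ≡ a (path i) ⊎ v ≡ d (path i) → v ∈ I₀
    end⇒∈I₀ end = proj₂ (proj₂ (proj₂ (proj₂ wis₀)) _) (_ , end)

  endProfile : Subset n → Vec (Bool × Bool) k
  endProfile J = tabulate (λ i → lookup J (a (path i)) , lookup J (d (path i)))

  endProfile-someTrue : ∀ {J} → Independent G J → covered OPT J ≗ covered OPT I₀ →
                        AllV SomeTrue (endProfile J)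
  endProfile-someTrue {J} independent cJ = tabulate⁺ λ i →
    ∨-bridge (end-covered (a (path i)) (inj₁ refl)) (end-covered (d (path i)) (inj₂ refl))
             (λ Jb Jc → independent (lookup⇒[]= _ J Jb) (lookup⇒[]= _ J Jc) (inner-edge (path i)))
    where
    end-covered : ∀ v {i} → v ≡ a (path i) ⊎ v ≡ d (path i) → covered OPT J v ≡ true
    end-covered v end = trans (cJ v) (covered-∈ OPT (end⇒∈I₀ end))
    inner-edge : (P : AugPath3 OPT R₀) → adj G (p (a P)) (p (d P)) ≡ true
    inner-edge P =
      subst₂ (λ x y → adj G x y ≡ true) (sym (ab-opt P)) (sym (partner-d P)) (R₀-edges (bc-R P))

  endProfile-injective : ∀ {J J′} → Transversal OPT J → Transversal OPT J′ →
                         covered OPT J ≗ covered OPT I₀ → covered OPT J′ ≗ covered OPT I₀ →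
                         endProfile J ≡ endProfile J′ → J ≡ J′
  endProfile-injective {J} {J′} tJ tJ′ cJ cJ′ eq = transversal-unique OPT tJ tJ′ cJ cJ′ agree
    where
    at : ∀ i → (lookup J (a (path i)) , lookup J (d (path i)))
             ≡ (lookup J′ (a (path i)) , lookup J′ (d (path i)))
    at i = trans (sym (lookup∘tabulate _ i)) (trans (cong (λ t → lookup t i) eq) (lookup∘tabulate _ i))
    agree : ∀ {v} → v ∈ I₀ → lookup J v ≡ lookup J′ v
    agree v∈I₀ with ∈I₀⇒end v∈I₀
    ... | i , inj₁ refl = cong proj₁ (at i)
    ... | i , inj₂ refl = cong proj₂ (at i)

  atMost-sameCover :
    AtMost (3 ^ k) (λ J → Transversal OPT J × Independent G J × covered OPT J ≗ covered OPT I₀)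
  atMost-sameCover = atMost-injection endProfile
    (λ {J} (_ , independent , cJ) → endProfile-someTrue {J} independent cJ)
    (λ (tJ , _ , cJ) (tJ′ , _ , cJ′) → endProfile-injective tJ tJ′ cJ cJ′)
    (atMost-All (Product.≡-dec Bool._≟_ Bool._≟_) atMost-someTrue k)

claim2p3 : ∀ (n : ℕ) (G : Graph n) (OPT : PerfectMatching G) (k : ℕ) → 1 ≤ k →
    (Is : List (Subset n)) → Unique Is → All (IsRankingWIS G OPT k) Is →
    length Is ≤ ((n / 2) C (2 * k)) * 3 ^ k
-- The bound holds for k = 0 as well.
claim2p3 n G OPT k _ =
  subst (λ m → AtMost ((m C (2 * k)) * 3 ^ k) (IsRankingWIS G OPT k)) (∣lowerEnds∣≡n/2 OPT)
    (atMost-fibres (≡-dec Bool._≟_) (coveredEdges OPT) code-size fibre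
                   (∣ lowerEnds OPT ∣ C (2 * k)) (atMost-subsets (lowerEnds OPT) (2 * k)))
  where
  code-size : ∀ {J} → IsRankingWIS G OPT k J →
              coveredEdges OPT J ⊆ lowerEnds OPT × ∣ coveredEdges OPT J ∣ ≡ 2 * k
  code-size {J} (_ , wis) =
    coveredEdges⊆lowerEnds OPT {J} , trans (∣coveredEdges∣ OPT (wis-transversal wis)) (proj₁ wis)
  fibre : ∀ X → AtMost (3 ^ k) (λ J → IsRankingWIS G OPT k J × coveredEdges OPT J ≡ X)
  fibre X = atMost-inhabited λ {J₀} ((π₀ , wis₀) , code₀) →
    atMost-weaken (λ {J} ((π , wis) , code) →
                     wis-transversal wis , wis-independent (ranking-maximal G π) wis ,
                     coveredEdges-injective OPT {J} {J₀} (trans code (sym code₀)))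
                  (atMost-sameCover OPT (ranking-edges G π₀) wis₀)
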